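{- For $n\ge 6$, with $T(n)$ and $L(n)$ as in the context, the number of non-empty cells in the left leaves (leaves that are left children) of $T(n)$ equals $L(n-L(n-2))$, and the number of non-empty cells in the right leaves of $T(n)$ equals $L(n-3-L(n-5))$. Hence $L(n)=L(n-L(n-2))+L(n-3-L(n-5))$.
   Context: Let $T$ be the following infinite binary tree, all of whose leaves lie on a single bottom level. There is a sequence of "s-nodes" $S_1,S_2,\dots$: $S_1$ has two children, both leaves; for $m\ge 2$, $S_m$ has left child $S_{m-1}$ and right child the root of a complete binary tree of the same height as the subtree rooted at $S_{m-1}$ (so the subtree rooted at each $S_m$ is a complete binary tree with all leaves on the bottom level). Nodes on the bottom level are leaves; each leaf has two cells (a left cell and a right cell). Nodes that are neither leaves nor s-nodes are regular nodes. For $n\ge0$, $T(n)$ is $T$ with labels $1,2,\dots,n$ inserted in preorder starting from the leftmost leaf (i.e. traversing the two leaf children of $S_1$, then the right subtree of $S_2$ in preorder, then the right subtree of $S_3$, etc.): s-nodes receive no label, each regular node receives one label, and each leaf receives three consecutive labels, the first in its left cell and the next two in its right cell (the last node reached may be only partially labelled). A cell is non-empty if it contains at least one label. $L(n)$ is the number of non-empty cells in $T(n)$. -}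

module Defs where

open import Data.Nat using (ℕ; zero; suc; _+_; _∸_; _⊓_)
open import Data.Product using (_×_; _,_)

data Tree : Set where
  leaf  : Tree                 -- a leaf (has a left cell and a right cell)
  reg   : Tree → Tree → Tree   -- a regular node (receives one label)
  snode : Tree → Tree → Tree   -- an s-node (receives no label)

complete : ℕ → Tree
complete zero    = leaf
complete (suc h) = reg (complete h) (complete h)

-- sSub k is the subtree of T rooted at the s-node S_{k+1}.
sSub : ℕ → Tree
sSub zero    = snode leaf leaf
sSub (suc k) = snode (sSub k) (complete (suc k))

data Side : Set where
  lft rgt : Side

-- Result of labelling: (labels still to insert ,
--   non-empty cells in left leaves , non-empty cells in right leaves)
Res : Set
Res = ℕ × ℕ × ℕ

-- Non-empty cells of a leaf when r labels remain to be inserted: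
-- its left cell gets the next label (if any), its right cell the next two.
leafCells : ℕ → ℕ
leafCells r = (r ⊓ 1) + ((r ∸ 1) ⊓ 1)

-- Insert the remaining r labels in preorder into a tree placed as the
-- given side child; s-nodes get no label, regular nodes one, leaves three.
mutual
  label : Side → Tree → ℕ → Res
  label lft leaf r = (r ∸ 3 , leafCells r , 0)
  label rgt leaf r = (r ∸ 3 , 0 , leafCells r)
  label s (reg a b)   r = label2 a b (r ∸ 1)
  label s (snode a b) r = label2 a b r

  label2 : Tree → Tree → ℕ → Res
  label2 a b r with label lft a r
  ... | (r₁ , x₁ , y₁) with label rgt b r₁
  ... | (r₂ , x₂ , y₂) = (r₂ , x₁ + x₂ , y₁ + y₂)

-- T(n) : the labels 1..n all lie within the subtree rooted at S_{n+1}
-- (it has 2^(n+1) leaves, hence room for ≥ 3·2^(n+1) ≥ n labels), so the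
-- labelling of T restricted to that subtree determines all counts below.
labelT : ℕ → Res
labelT n = label lft (sSub n) n

leftLeafCells : ℕ → ℕ
leftLeafCells n with labelT n
... | (_ , x , _) = x

rightLeafCells : ℕ → ℕ
rightLeafCells n with labelT n
... | (_ , _ , y) = y

L : ℕ → ℕ
L n = leftLeafCells n + rightLeafCells n

-- Read the label slots of T in preorder and mark a slot 1 when its label is
-- the first one in a cell.  Restricting the marks to left leaves, to right
-- leaves or to all leaves gives words x, y, a whose prefix sums of length n
-- are the counts of T(n) (label-counts); the subtree at S_{n+1} suffices.
--   * Right leaves.  Leaves come in sibling pairs, left first, so y is x
--     delayed by three slots (Delayed): rightLeafCells n = leftLeafCells (n − 3).
--   * Left leaves.  Contracting each bottom pair of sibling leaves to a single
--     leaf maps the subtree at S_{k+2} onto the subtree at S_{k+1}; its word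
--     a' is again a word of T.  Every left leaf becomes a contracted leaf, and
--     position n of a corresponds to position n − (a-count at n − 2) of a'
--     (initial-counts).  This correspondence is a property of segments of
--     words (Segment) that is preserved by concatenation (++-segment) and
--     checked directly on the three kinds of pieces: the leaves of S₁, a
--     bottom pair under its parent, and a regular node.
-- Prefix sums of a' are values of L, so leftLeafCells n = L(n − L(n − 2)).
-- Both identities hold for every n.

module Submission where

open import Defs
open import Data.Nat using (ℕ; zero; suc; _+_; _∸_; _≤_; _<_; z≤n; s≤s; z<s)
open import Data.Nat.Properties
open import Data.Nat.ListAction using (sum)
open import Data.Nat.ListAction.Properties using (sum-++)
open import Data.List using (List; []; _∷_; _++_; length)
open import Data.List.Properties using (length-++; length-++-≤ˡ; ++-assoc; ++-identityʳ)
open import Data.Product using (Σ; _×_; _,_)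
open import Function using (_∘_)
open import Relation.Binary.PropositionalEquality
open import Data.Nat.Tactic.RingSolver using (solve-∀)
open import Algebra.Properties.CommutativeSemigroup +-commutativeSemigroup using (interchange)

psum : List ℕ → ℕ → ℕ
psum xs       zero    = 0
psum []       (suc n) = 0
psum (x ∷ xs) (suc n) = x + psum xs n

psum-[] : ∀ n → psum [] n ≡ 0
psum-[] zero    = refl
psum-[] (suc n) = refl

psum-++ : ∀ xs ys n → psum (xs ++ ys) n ≡ psum xs n + psum ys (n ∸ length xs)
psum-++ []       ys n       = sym (cong (_+ psum ys n) (psum-[] n))
psum-++ (x ∷ xs) ys zero    = refl
psum-++ (x ∷ xs) ys (suc n) =
  trans (cong (x +_) (psum-++ xs ys n)) (sym (+-assoc x _ _))

psum-all : ∀ xs {n} → length xs ≤ n → psum xs n ≡ sum xs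
psum-all []       {n}     _         = psum-[] n
psum-all (x ∷ xs) {suc n} (s≤s len) = cong (x +_) (psum-all xs len)

psum-prefix : ∀ xs ys {n} → n ≤ length xs → psum (xs ++ ys) n ≡ psum xs n
psum-prefix xs ys {n} n≤len = begin
  psum (xs ++ ys) n                    ≡⟨ psum-++ xs ys n ⟩
  psum xs n + psum ys (n ∸ length xs)  ≡⟨ cong (λ k → psum xs n + psum ys k) (m≤n⇒m∸n≡0 n≤len) ⟩
  psum xs n + 0                        ≡⟨ +-identityʳ _ ⟩
  psum xs n                            ∎
  where open ≡-Reasoning

psum-beyond : ∀ xs ys k → psum (xs ++ ys) (length xs + k) ≡ sum xs + psum ys k
psum-beyond xs ys k = begin
  psum (xs ++ ys) (length xs + k)                           ≡⟨ psum-++ xs ys _ ⟩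
  psum xs (length xs + k) + psum ys (length xs + k ∸ length xs)
    ≡⟨ cong₂ _+_ (psum-all xs (m≤m+n (length xs) k)) (cong (psum ys) (m+n∸m≡n (length xs) k)) ⟩
  sum xs + psum ys k                                        ∎
  where open ≡-Reasoning

-- If the last entry of xs is zero (i.e. the sum of all but the last entry is
-- the total), then one position before the end of xs all of xs is counted.
psum-beyond-pred : ∀ xs ys → psum xs (length xs ∸ 1) ≡ sum xs →
  ∀ k → psum (xs ++ ys) (length xs + k ∸ 1) ≡ sum xs + psum ys (k ∸ 1)
psum-beyond-pred xs ys last zero = begin
  psum (xs ++ ys) (length xs + 0 ∸ 1)  ≡⟨ cong (λ m → psum (xs ++ ys) (m ∸ 1)) (+-identityʳ (length xs)) ⟩
  psum (xs ++ ys) (length xs ∸ 1)      ≡⟨ psum-prefix xs ys (m∸n≤m _ 1) ⟩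
  psum xs (length xs ∸ 1)              ≡⟨ last ⟩
  sum xs                               ≡⟨ +-identityʳ _ ⟨
  sum xs + 0                           ∎
  where open ≡-Reasoning
psum-beyond-pred xs ys last (suc k) =
  trans (cong (λ m → psum (xs ++ ys) (m ∸ 1)) (+-suc (length xs) k)) (psum-beyond xs ys k)

-- The word of a leaf whose cells are not counted, and the word of a leaf
-- whose cells are: one entry per label slot, 1 where the label is the first
-- in its cell (left cell; right cell; right cell again).
zeros : List ℕ
zeros = 0 ∷ 0 ∷ 0 ∷ []

leaf-cells : List ℕ
leaf-cells = 1 ∷ 1 ∷ 0 ∷ []

psum-zeros : ∀ n → psum zeros n ≡ 0
psum-zeros 0 = refl
psum-zeros 1 = refl
psum-zeros 2 = refl
psum-zeros (suc (suc (suc n))) = psum-[] n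

-- The bound j ≤ |a'| keeps j inside
-- the segment, which concatenation needs.
Tracks : ℕ → List ℕ → List ℕ → List ℕ → ℕ → Set
Tracks c x a a' i = Σ ℕ λ j →
  j ≤ length a' × j + psum a (i ∸ 1) ≡ i + c × psum x (suc i) ≡ psum a' j

-- A segment (x, a, a') with offset c: a piece of the words x and a together
-- with the word a' of its contraction.  Contraction removes one slot per
-- cell mark (balance), x and a' have equal totals, a ends with a 0 entry
-- (last-a), and every position is tracked.  Interior pieces have offset 0;
-- the piece at the start of the tree has offset 1.
record Segment (c : ℕ) (x a a' : List ℕ) : Set where
  field
    length-x : length x ≡ length a
    balance  : length a + c ≡ length a' + sum a
    sum-x    : sum x ≡ sum a'
    last-a   : psum a (length a ∸ 1) ≡ sum a
    tracks   : ∀ i → i < length a → Tracks c x a a' i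

split-< : ∀ {A : ℕ → Set} m n → (∀ i → i < m → A i) → (∀ k → k < n → A (m + k)) →
          ∀ i → i < m + n → A i
split-< zero    n below above i       i<n             = above i i<n
split-< (suc m) n below above zero    _               = below zero z<s
split-< {A} (suc m) n below above (suc i) (s≤s i<m+n) =
  split-< {A ∘ suc} m n (λ i i<m → below (suc i) (s≤s i<m)) above i i<m+n

-- Moving an offset r from the end to the first summand (the second summand
-- carries the offset 0 of an interior segment).
move-offset : ∀ p q r → p + q + r ≡ (p + r) + (q + 0)
move-offset = solve-∀

tracks-++ˡ : ∀ {c x₁ a₁ a'₁} x₂ a₂ a'₂ → Segment c x₁ a₁ a'₁ →
  ∀ i → i < length a₁ → Tracks c (x₁ ++ x₂) (a₁ ++ a₂) (a'₁ ++ a'₂) i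
tracks-++ˡ {c} {x₁} {a₁} {a'₁} x₂ a₂ a'₂ S₁ i i<len with Segment.tracks S₁ i i<len
... | j , j≤len , offset , counts =
  j , ≤-trans j≤len (length-++-≤ˡ a'₁)
    , trans (cong (j +_) (psum-prefix a₁ a₂ (≤-trans (m∸n≤m i 1) (<⇒≤ i<len)))) offset
    , (begin
        psum (x₁ ++ x₂) (suc i)  ≡⟨ psum-prefix x₁ x₂ (subst (suc i ≤_) (sym (Segment.length-x S₁)) i<len) ⟩
        psum x₁ (suc i)          ≡⟨ counts ⟩
        psum a'₁ j               ≡⟨ psum-prefix a'₁ a'₂ j≤len ⟨
        psum (a'₁ ++ a'₂) j      ∎)
  where open ≡-Reasoning

tracks-++ʳ : ∀ {c x₁ a₁ a'₁ x₂ a₂ a'₂} → Segment c x₁ a₁ a'₁ → Segment 0 x₂ a₂ a'₂ →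
  ∀ k → k < length a₂ → Tracks c (x₁ ++ x₂) (a₁ ++ a₂) (a'₁ ++ a'₂) (length a₁ + k)
tracks-++ʳ {c} {x₁} {a₁} {a'₁} {x₂} {a₂} {a'₂} S₁ S₂ k k<len with Segment.tracks S₂ k k<len
... | j , j≤len , offset , counts =
  length a'₁ + j
    , subst (length a'₁ + j ≤_) (sym (length-++ a'₁)) (+-monoʳ-≤ (length a'₁) j≤len)
    , (begin
        length a'₁ + j + psum (a₁ ++ a₂) (length a₁ + k ∸ 1)
          ≡⟨ cong (length a'₁ + j +_) (psum-beyond-pred a₁ a₂ (last-a S₁) k) ⟩
        length a'₁ + j + (sum a₁ + psum a₂ (k ∸ 1))
          ≡⟨ interchange (length a'₁) j (sum a₁) (psum a₂ (k ∸ 1)) ⟩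
        (length a'₁ + sum a₁) + (j + psum a₂ (k ∸ 1))
          ≡⟨ cong₂ _+_ (balance S₁) (sym offset) ⟨
        (length a₁ + c) + (k + 0)
          ≡⟨ move-offset (length a₁) k c ⟨
        length a₁ + k + c                                     ∎)
    , (begin
        psum (x₁ ++ x₂) (suc (length a₁ + k))
          ≡⟨ cong (psum (x₁ ++ x₂)) (trans (sym (+-suc (length a₁) k)) (cong (_+ suc k) (sym (length-x S₁)))) ⟩
        psum (x₁ ++ x₂) (length x₁ + suc k)  ≡⟨ psum-beyond x₁ x₂ (suc k) ⟩
        sum x₁ + psum x₂ (suc k)             ≡⟨ cong₂ _+_ (sum-x S₁) counts ⟩
        sum a'₁ + psum a'₂ j                 ≡⟨ psum-beyond a'₁ a'₂ j ⟨
        psum (a'₁ ++ a'₂) (length a'₁ + j)   ∎)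
  where
  open Segment
  open ≡-Reasoning

++-segment : ∀ {c x₁ a₁ a'₁ x₂ a₂ a'₂} →
  Segment c x₁ a₁ a'₁ → Segment 0 x₂ a₂ a'₂ →
  Segment c (x₁ ++ x₂) (a₁ ++ a₂) (a'₁ ++ a'₂)
++-segment {c} {x₁} {a₁} {a'₁} {x₂} {a₂} {a'₂} S₁ S₂ = record
  { length-x = begin
      length (x₁ ++ x₂)          ≡⟨ length-++ x₁ ⟩
      length x₁ + length x₂      ≡⟨ cong₂ _+_ (length-x S₁) (length-x S₂) ⟩
      length a₁ + length a₂      ≡⟨ length-++ a₁ ⟨
      length (a₁ ++ a₂)          ∎
  ; balance = begin
      length (a₁ ++ a₂) + c                    ≡⟨ cong (_+ c) (length-++ a₁) ⟩
      length a₁ + length a₂ + c                ≡⟨ move-offset (length a₁) (length a₂) c ⟩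
      (length a₁ + c) + (length a₂ + 0)        ≡⟨ cong₂ _+_ (balance S₁) (balance S₂) ⟩
      (length a'₁ + sum a₁) + (length a'₂ + sum a₂)
                                               ≡⟨ interchange (length a'₁) (sum a₁) (length a'₂) (sum a₂) ⟩
      (length a'₁ + length a'₂) + (sum a₁ + sum a₂)
                                               ≡⟨ cong₂ _+_ (length-++ a'₁) (sum-++ a₁ a₂) ⟨
      length (a'₁ ++ a'₂) + sum (a₁ ++ a₂)     ∎
  ; sum-x = begin
      sum (x₁ ++ x₂)        ≡⟨ sum-++ x₁ x₂ ⟩
      sum x₁ + sum x₂       ≡⟨ cong₂ _+_ (sum-x S₁) (sum-x S₂) ⟩
      sum a'₁ + sum a'₂     ≡⟨ sum-++ a'₁ a'₂ ⟨
      sum (a'₁ ++ a'₂)      ∎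
  ; last-a = begin
      psum (a₁ ++ a₂) (length (a₁ ++ a₂) ∸ 1)       ≡⟨ cong (λ m → psum (a₁ ++ a₂) (m ∸ 1)) (length-++ a₁) ⟩
      psum (a₁ ++ a₂) (length a₁ + length a₂ ∸ 1)   ≡⟨ psum-beyond-pred a₁ a₂ (last-a S₁) (length a₂) ⟩
      sum a₁ + psum a₂ (length a₂ ∸ 1)              ≡⟨ cong (sum a₁ +_) (last-a S₂) ⟩
      sum a₁ + sum a₂                               ≡⟨ sum-++ a₁ a₂ ⟨
      sum (a₁ ++ a₂)                                ∎
  ; tracks = λ i i<len → split-< (length a₁) (length a₂)
                           (tracks-++ˡ x₂ a₂ a'₂ S₁) (tracks-++ʳ S₁ S₂) i
                           (subst (i <_) (length-++ a₁) i<len)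
  }
  where
  open Segment
  open ≡-Reasoning

initial-counts : ∀ {x a a'} → Segment 1 x a a' →
  ∀ n → n ≤ length a → psum x n ≡ psum a' (n ∸ psum a (n ∸ 2))
initial-counts S zero    _     = refl
initial-counts {x} {a} {a'} S (suc i) i<len with Segment.tracks S i i<len
... | j , _ , offset , counts = trans counts (cong (psum a') j≡)
  where
  j≡ : j ≡ suc i ∸ psum a (i ∸ 1)
  j≡ = sym (begin
    suc i ∸ psum a (i ∸ 1)                 ≡⟨ cong (_∸ psum a (i ∸ 1)) (+-comm 1 i) ⟩
    i + 1 ∸ psum a (i ∸ 1)                 ≡⟨ cong (_∸ psum a (i ∸ 1)) offset ⟨
    j + psum a (i ∸ 1) ∸ psum a (i ∸ 1)    ≡⟨ m+n∸n≡m j (psum a (i ∸ 1)) ⟩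
    j                                      ∎)
    where open ≡-Reasoning

-- A regular node above the bottom level: one label, no cell; it remains a
-- regular node after contraction.
node-segment : Segment 0 (0 ∷ []) (0 ∷ []) (0 ∷ [])
node-segment = record
  { length-x = refl ; balance = refl ; sum-x = refl ; last-a = refl
  ; tracks   = λ { zero _ → 0 , z≤n , refl , refl ; (suc _) (s≤s ()) } }

-- A bottom regular node with its two leaves (7 labels); contracted to a leaf.
pair-segment : Segment 0 (0 ∷ leaf-cells ++ zeros) (0 ∷ leaf-cells ++ leaf-cells) leaf-cells
pair-segment = record
  { length-x = refl ; balance = refl ; sum-x = refl ; last-a = refl ; tracks = pair-tracks }
  where
  pair-tracks : ∀ i → i < 7 → Tracks 0 (0 ∷ leaf-cells ++ zeros) (0 ∷ leaf-cells ++ leaf-cells) leaf-cells i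
  pair-tracks 0 _ = 0 , z≤n , refl , refl
  pair-tracks 1 _ = 1 , s≤s z≤n , refl , refl
  pair-tracks 2 _ = 2 , s≤s (s≤s z≤n) , refl , refl
  pair-tracks 3 _ = 2 , s≤s (s≤s z≤n) , refl , refl
  pair-tracks 4 _ = 2 , s≤s (s≤s z≤n) , refl , refl
  pair-tracks 5 _ = 3 , s≤s (s≤s (s≤s z≤n)) , refl , refl
  pair-tracks 6 _ = 3 , s≤s (s≤s (s≤s z≤n)) , refl , refl
  pair-tracks (suc (suc (suc (suc (suc (suc (suc _)))))))
              (s≤s (s≤s (s≤s (s≤s (s≤s (s≤s (s≤s ())))))))

-- The two leaves of S₁ (6 labels, S₁ itself gets none); contracted to a leaf.
first-segment : Segment 1 (leaf-cells ++ zeros) (leaf-cells ++ leaf-cells) leaf-cells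
first-segment = record
  { length-x = refl ; balance = refl ; sum-x = refl ; last-a = refl ; tracks = first-tracks }
  where
  first-tracks : ∀ i → i < 6 → Tracks 1 (leaf-cells ++ zeros) (leaf-cells ++ leaf-cells) leaf-cells i
  first-tracks 0 _ = 1 , s≤s z≤n , refl , refl
  first-tracks 1 _ = 2 , s≤s (s≤s z≤n) , refl , refl
  first-tracks 2 _ = 2 , s≤s (s≤s z≤n) , refl , refl
  first-tracks 3 _ = 2 , s≤s (s≤s z≤n) , refl , refl
  first-tracks 4 _ = 3 , s≤s (s≤s (s≤s z≤n)) , refl , refl
  first-tracks 5 _ = 3 , s≤s (s≤s (s≤s z≤n)) , refl , refl
  first-tracks (suc (suc (suc (suc (suc (suc _))))))
               (s≤s (s≤s (s≤s (s≤s (s≤s (s≤s ()))))))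

-- y is x delayed by three positions.
record Delayed (y x : List ℕ) : Set where
  constructor delayed
  field delay : y ++ zeros ≡ zeros ++ x

node-delayed : Delayed (0 ∷ []) (0 ∷ [])
node-delayed = delayed refl

++-delayed : ∀ {y₁ x₁ y₂ x₂} → Delayed y₁ x₁ → Delayed y₂ x₂ → Delayed (y₁ ++ y₂) (x₁ ++ x₂)
++-delayed {y₁} {x₁} {y₂} {x₂} (delayed d₁) (delayed d₂) = delayed (begin
  (y₁ ++ y₂) ++ zeros   ≡⟨ ++-assoc y₁ y₂ zeros ⟩
  y₁ ++ (y₂ ++ zeros)   ≡⟨ cong (y₁ ++_) d₂ ⟩
  y₁ ++ (zeros ++ x₂)   ≡⟨ ++-assoc y₁ zeros x₂ ⟨
  (y₁ ++ zeros) ++ x₂   ≡⟨ cong (_++ x₂) d₁ ⟩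
  (zeros ++ x₁) ++ x₂   ≡⟨ ++-assoc zeros x₁ x₂ ⟩
  zeros ++ (x₁ ++ x₂)   ∎)
  where open ≡-Reasoning

delayed-psum : ∀ {y x} → Delayed y x → ∀ n → psum y n ≡ psum x (n ∸ 3)
delayed-psum {y} {x} (delayed d) n = begin
  psum y n                                ≡⟨ +-identityʳ _ ⟨
  psum y n + 0                            ≡⟨ cong (psum y n +_) (psum-zeros (n ∸ length y)) ⟨
  psum y n + psum zeros (n ∸ length y)    ≡⟨ psum-++ y zeros n ⟨
  psum (y ++ zeros) n                     ≡⟨ cong (λ w → psum w n) d ⟩
  psum (zeros ++ x) n                     ≡⟨ psum-++ zeros x n ⟩
  psum zeros n + psum x (n ∸ 3)           ≡⟨ cong (_+ psum x (n ∸ 3)) (psum-zeros n) ⟩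
  psum x (n ∸ 3)                          ∎
  where open ≡-Reasoning

size : Tree → ℕ
size leaf        = 3
size (reg a b)   = suc (size a + size b)
size (snode a b) = size a + size b

-- A marking gives each leaf, according to its side, a weight for each of
-- its three label slots (left cell; right cell; right cell again).
Marking : Set
Marking = Side → ℕ × ℕ × ℕ

slots : ℕ × ℕ × ℕ → List ℕ
slots (p , q , r) = p ∷ q ∷ r ∷ []

word : Marking → Side → Tree → List ℕ
word m s leaf        = slots (m s)
word m s (reg a b)   = 0 ∷ word m lft a ++ word m rgt b
word m s (snode a b) = word m lft a ++ word m rgt b

left-marks right-marks cell-marks : Marking
left-marks lft  = 1 , 1 , 0
left-marks rgt  = 0 , 0 , 0
right-marks lft = 0 , 0 , 0
right-marks rgt = 1 , 1 , 0
cell-marks _    = 1 , 1 , 0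

length-word : ∀ m s t → length (word m s t) ≡ size t
length-word m s leaf        = refl
length-word m s (reg a b)   =
  cong suc (trans (length-++ (word m lft a)) (cong₂ _+_ (length-word m lft a) (length-word m rgt b)))
length-word m s (snode a b) =
  trans (length-++ (word m lft a)) (cong₂ _+_ (length-word m lft a) (length-word m rgt b))

psum-node : ∀ m a b r →
  psum (word m lft a ++ word m rgt b) r ≡ psum (word m lft a) r + psum (word m rgt b) (r ∸ size a)
psum-node m a b r = trans (psum-++ (word m lft a) (word m rgt b) r)
  (cong (λ k → psum (word m lft a) r + psum (word m rgt b) (r ∸ k)) (length-word m lft a))

leafCells-slots : ∀ r → leafCells r ≡ psum leaf-cells r
leafCells-slots 0 = refl
leafCells-slots 1 = refl
leafCells-slots 2 = refl
leafCells-slots (suc (suc (suc r))) = cong (2 +_) (sym (psum-[] r))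

mutual
  label-counts : ∀ s t r →
    label s t r ≡ (r ∸ size t , psum (word left-marks s t) r , psum (word right-marks s t) r)
  label-counts lft leaf r = cong₂ (λ p q → r ∸ 3 , p , q) (leafCells-slots r) (sym (psum-zeros r))
  label-counts rgt leaf r = cong₂ (λ p q → r ∸ 3 , p , q) (sym (psum-zeros r)) (leafCells-slots r)
  label-counts lft (reg a b)   r = reg-counts a b r
  label-counts rgt (reg a b)   r = reg-counts a b r
  label-counts lft (snode a b) r = label2-counts a b r
  label-counts rgt (snode a b) r = label2-counts a b r

  reg-counts : ∀ a b r → label2 a b (r ∸ 1) ≡
    (r ∸ size (reg a b) , psum (word left-marks lft (reg a b)) r , psum (word right-marks lft (reg a b)) r)
  reg-counts a b zero    = trans (label2-counts a b 0) (cong (λ k → k , 0 , 0) (0∸n≡0 (size a + size b)))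
  reg-counts a b (suc r) = label2-counts a b r

  label2-counts : ∀ a b r → label2 a b r ≡
    (r ∸ (size a + size b) , psum (word left-marks lft a ++ word left-marks rgt b) r
                           , psum (word right-marks lft a ++ word right-marks rgt b) r)
  label2-counts a b r with label lft a r | label-counts lft a r
  ... | ._ | refl with label rgt b (r ∸ size a) | label-counts rgt b (r ∸ size a)
  ... | ._ | refl = cong₂ _,_ (∸-+-assoc r (size a) (size b))
                      (cong₂ _,_ (sym (psum-node left-marks a b r)) (sym (psum-node right-marks a b r)))

mutual
  cells-split : ∀ s t r →
    psum (word left-marks s t) r + psum (word right-marks s t) r ≡ psum (word cell-marks s t) r
  cells-split lft leaf r = trans (cong (psum leaf-cells r +_) (psum-zeros r)) (+-identityʳ _)
  cells-split rgt leaf r = cong (_+ psum leaf-cells r) (psum-zeros r)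
  cells-split s (reg a b) zero    = refl
  cells-split s (reg a b) (suc r) = children-split a b r
  cells-split s (snode a b) r     = children-split a b r

  children-split : ∀ a b r →
    psum (word left-marks lft a ++ word left-marks rgt b) r
      + psum (word right-marks lft a ++ word right-marks rgt b) r
    ≡ psum (word cell-marks lft a ++ word cell-marks rgt b) r
  children-split a b r = begin
    psum (Xa ++ Xb) r + psum (Ya ++ Yb) r
      ≡⟨ cong₂ _+_ (psum-node left-marks a b r) (psum-node right-marks a b r) ⟩
    (psum Xa r + psum Xb r′) + (psum Ya r + psum Yb r′)
      ≡⟨ interchange (psum Xa r) (psum Xb r′) (psum Ya r) (psum Yb r′) ⟩
    (psum Xa r + psum Ya r) + (psum Xb r′ + psum Yb r′)
      ≡⟨ cong₂ _+_ (cells-split lft a r) (cells-split rgt b r′) ⟩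
    psum (word cell-marks lft a) r + psum (word cell-marks rgt b) r′
      ≡⟨ psum-node cell-marks a b r ⟨
    psum (word cell-marks lft a ++ word cell-marks rgt b) r
      ∎
    where
    open ≡-Reasoning
    Xa Xb Ya Yb : List ℕ
    Xa = word left-marks lft a
    Xb = word left-marks rgt b
    Ya = word right-marks lft a
    Yb = word right-marks rgt b
    r′ : ℕ
    r′ = r ∸ size a

sSub-prefix : ∀ m k d → Σ (List ℕ) λ ys → word m lft (sSub (d + k)) ≡ word m lft (sSub k) ++ ys
sSub-prefix m k zero    = [] , sym (++-identityʳ _)
sSub-prefix m k (suc d) with sSub-prefix m k d
... | ys , eq = ys ++ word m rgt (complete (suc (d + k)))
              , trans (cong (_++ word m rgt (complete (suc (d + k)))) eq) (++-assoc (word m lft (sSub k)) ys _)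

size-sSub : ∀ k → k ≤ size (sSub k)
size-sSub zero    = z≤n
size-sSub (suc k) = subst (_≤ size (sSub (suc k))) (+-comm k 1) (+-mono-≤ (size-sSub k) (s≤s z≤n))

-- The first n labels land in the same places in every subtree at S_{N+1},
-- N ≥ n, so prefix sums of length n agree.
psum-stable : ∀ m {n N} → n ≤ N → psum (word m lft (sSub n)) n ≡ psum (word m lft (sSub N)) n
psum-stable m {n} {N} n≤N with sSub-prefix m n (N ∸ n)
... | ys , eq = begin
  psum (word m lft (sSub n)) n                ≡⟨ psum-prefix (word m lft (sSub n)) ys n≤len ⟨
  psum (word m lft (sSub n) ++ ys) n          ≡⟨ cong (λ w → psum w n) eq ⟨
  psum (word m lft (sSub (N ∸ n + n))) n      ≡⟨ cong (λ k → psum (word m lft (sSub k)) n) (m∸n+n≡m n≤N) ⟩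
  psum (word m lft (sSub N)) n                ∎
  where
  open ≡-Reasoning
  n≤len : n ≤ length (word m lft (sSub n))
  n≤len = subst (n ≤_) (sym (length-word m lft (sSub n))) (size-sSub n)

leftLeafCells-word : ∀ n → leftLeafCells n ≡ psum (word left-marks lft (sSub n)) n
leftLeafCells-word n with labelT n | label-counts lft (sSub n) n
... | ._ | refl = refl

rightLeafCells-word : ∀ n → rightLeafCells n ≡ psum (word right-marks lft (sSub n)) n
rightLeafCells-word n with labelT n | label-counts lft (sSub n) n
... | ._ | refl = refl

leftLeafCells-at : ∀ {n N} → n ≤ N → leftLeafCells n ≡ psum (word left-marks lft (sSub N)) n
leftLeafCells-at {n} n≤N = trans (leftLeafCells-word n) (psum-stable left-marks n≤N)

L-at : ∀ {n N} → n ≤ N → L n ≡ psum (word cell-marks lft (sSub N)) n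
L-at {n} {N} n≤N = begin
  leftLeafCells n + rightLeafCells n
    ≡⟨ cong₂ _+_ (leftLeafCells-word n) (rightLeafCells-word n) ⟩
  psum (word left-marks lft (sSub n)) n + psum (word right-marks lft (sSub n)) n
    ≡⟨ cells-split lft (sSub n) n ⟩
  psum (word cell-marks lft (sSub n)) n
    ≡⟨ psum-stable cell-marks n≤N ⟩
  psum (word cell-marks lft (sSub N)) n
    ∎
  where open ≡-Reasoning

-- Contracting every bottom pair of leaves of a complete tree of height
-- h + 1 to a single leaf gives the complete tree of height h ...
segment-complete : ∀ s h → Segment 0 (word left-marks s (complete (suc h)))
                                     (word cell-marks s (complete (suc h)))
                                     (word cell-marks s (complete h))
segment-complete s zero    = pair-segment
segment-complete s (suc h) =
  ++-segment node-segment (++-segment (segment-complete lft h) (segment-complete rgt h))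

-- ... and turns the subtree at S_{k+2} into the subtree at S_{k+1}.
segment-sSub : ∀ k → Segment 1 (word left-marks lft (sSub (suc k)))
                               (word cell-marks lft (sSub (suc k)))
                               (word cell-marks lft (sSub k))
segment-sSub zero    = ++-segment first-segment (segment-complete rgt zero)
segment-sSub (suc k) = ++-segment (segment-sSub k) (segment-complete rgt (suc k))

-- Leaves come in sibling pairs, left leaf first, so right-leaf marks are
-- left-leaf marks delayed by the three labels of the left leaf.
delayed-complete : ∀ s h → Delayed (word right-marks s (complete (suc h)))
                                   (word left-marks s (complete (suc h)))
delayed-complete s zero    = delayed refl
delayed-complete s (suc h) =
  ++-delayed node-delayed (++-delayed (delayed-complete lft h) (delayed-complete rgt h))

delayed-sSub : ∀ k → Delayed (word right-marks lft (sSub k)) (word left-marks lft (sSub k))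
delayed-sSub zero    = delayed refl
delayed-sSub (suc k) = ++-delayed (delayed-sSub k) (delayed-complete rgt k)

left-cells : ∀ n → leftLeafCells n ≡ L (n ∸ L (n ∸ 2))
left-cells n = begin
  leftLeafCells n                     ≡⟨ leftLeafCells-at (n≤1+n n) ⟩
  psum (X (suc n)) n                  ≡⟨ initial-counts (segment-sSub n) n n≤len ⟩
  psum (A n) (n ∸ psum (A (suc n)) (n ∸ 2))
                                      ≡⟨ cong (λ k → psum (A n) (n ∸ k)) (L-at (≤-trans (m∸n≤m n 2) (n≤1+n n))) ⟨
  psum (A n) (n ∸ L (n ∸ 2))          ≡⟨ L-at (m∸n≤m n (L (n ∸ 2))) ⟨
  L (n ∸ L (n ∸ 2))                   ∎
  where
  open ≡-Reasoning
  X A : ℕ → List ℕ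
  X k = word left-marks lft (sSub k)
  A k = word cell-marks lft (sSub k)
  n≤len : n ≤ length (A (suc n))
  n≤len = subst (n ≤_) (sym (length-word cell-marks lft (sSub (suc n))))
                (≤-trans (n≤1+n n) (size-sSub (suc n)))

right-cells : ∀ n → rightLeafCells n ≡ leftLeafCells (n ∸ 3)
right-cells n = begin
  rightLeafCells n                                 ≡⟨ rightLeafCells-word n ⟩
  psum (word right-marks lft (sSub n)) n           ≡⟨ delayed-psum (delayed-sSub n) n ⟩
  psum (word left-marks lft (sSub n)) (n ∸ 3)      ≡⟨ leftLeafCells-at (m∸n≤m n 3) ⟨
  leftLeafCells (n ∸ 3)                            ∎
  where open ≡-Reasoning

theorem3p3 : (n : ℕ) → 6 ≤ n →
    (leftLeafCells n ≡ L (n ∸ L (n ∸ 2)))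
    × (rightLeafCells n ≡ L (n ∸ 3 ∸ L (n ∸ 5)))
    × (L n ≡ L (n ∸ L (n ∸ 2)) + L (n ∸ 3 ∸ L (n ∸ 5)))
theorem3p3 n _ = left , right , cong₂ _+_ left right
  where
  left : leftLeafCells n ≡ L (n ∸ L (n ∸ 2))
  left = left-cells n
  right : rightLeafCells n ≡ L (n ∸ 3 ∸ L (n ∸ 5))
  right = begin
    rightLeafCells n               ≡⟨ right-cells n ⟩
    leftLeafCells (n ∸ 3)          ≡⟨ left-cells (n ∸ 3) ⟩
    L (n ∸ 3 ∸ L (n ∸ 3 ∸ 2))      ≡⟨ cong (λ k → L (n ∸ 3 ∸ L k)) (∸-+-assoc n 3 2) ⟩
    L (n ∸ 3 ∸ L (n ∸ 5))          ∎
    where open ≡-Reasoning
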